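{- Let $i,N\in\mathbb{N}$ and let $m,m_1,m_2$ be integers with $0\le m,m_1,m_2\le\binom{N}{i}$ and $m_1+m_2=m+\binom{N}{i}$. Then \[ m_1^{(i)}+m_2^{(i)}\le m^{(i)}+\binom{N}{i+1}. \]
   Context: $\mathbb{N}=\{1,2,3,\dots\}$. For $m,i\in\mathbb{N}$ there is a unique representation $m=\binom{n_i}{i}+\binom{n_{i-1}}{i-1}+\cdots+\binom{n_j}{j}$ with $n_i>n_{i-1}>\cdots>n_j\ge j\ge 1$, and the upper $i$-boundary is $m^{(i)}=\binom{n_i}{i+1}+\binom{n_{i-1}}{i}+\cdots+\binom{n_j}{j+1}$; by convention $0^{(i)}=0$. -}

module Defs where

open import Data.Nat using (ℕ; zero; suc; _+_; _∸_; _≤ᵇ_)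
open import Data.Nat.Combinatorics using (_C_)
open import Data.Bool using (if_then_else_)

-- Largest n with n ≤ bound and (n C i) ≤ m (0 if none); searched downward.
largest : (i m bound : ℕ) → ℕ
largest i m zero = zero
largest i m (suc b) = if (suc b C i) ≤ᵇ m then suc b else largest i m b

-- Upper i-boundary computed from the (greedy = unique) i-binomial representation
--   m = C(n_i,i) + C(n_{i-1},i-1) + ... + C(n_j,j),  n_i > ... > n_j ≥ j ≥ 1,
-- giving  m^(i) = C(n_i,i+1) + ... + C(n_j,j+1);  0^(i) = 0.
-- Since C(n,i) ≥ n - i + 1 for i ≥ 1, n_i ≤ m + i, so bound m + i suffices.
upperBoundary : (i m : ℕ) → ℕ
upperBoundary zero m = zero
upperBoundary (suc i) zero = zero
upperBoundary (suc i) (suc m) =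
  let n = largest (suc i) (suc m) (suc m + suc i)
  in (n C suc (suc i)) + upperBoundary i (suc m ∸ (n C suc i))

infix 30 _⁽_⁾
_⁽_⁾ : ℕ → ℕ → ℕ
m ⁽ i ⁾ = upperBoundary i m

module Submission where

-- Writing m₁ = m + L and m₂ = m + w, the hypothesis reads m + L + w = C(N,i).
-- In this form the inequality is proved by induction on the level i together
-- with two companions (record `BoundaryLaws`): superadditivity of the
-- i-boundary, and the layer bound (x + C(n,i-1))^(i) ≤ x^(i) + C(n,i).
--
-- Level 1 is explicit, m^(1) = C(m,2) (`laws-one`).  The
-- passage from level i to i+1 (module `Ascend`) is an induction on the row n,
-- splitting C(n+1,i+1) = C(n,i) + C(n,i+1); besides `boundary-shift` it uses
-- the unimodality of the rows of Pascal's triangle (`choose-unimodal`).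

open import Defs
open import Data.Nat using (ℕ; suc; _+_; _≤_)
open import Data.Nat.Combinatorics using (_C_)
open import Relation.Binary.PropositionalEquality using (_≡_)

open import Data.Nat using (zero; _*_; _∸_; _<_; _≤′_; ≤′-refl; ≤′-step; _≤?_; _≤ᵇ_; z≤n; s≤s)
open import Data.Nat.Properties
open import Data.Nat.Combinatorics using (nCk+nC[k+1]≡[n+1]C[k+1])
open import Data.Nat.Tactic.RingSolver using (solve-∀)
open import Algebra.Properties.CommutativeSemigroup +-commutativeSemigroup
  using (interchange; x∙yz≈y∙xz; x∙yz≈yx∙z; x∙yz≈xz∙y; x∙yz≈y∙zx; xy∙z≈xz∙y; xy∙z≈x∙zy)
open import Data.Bool using (true; false; T)
open import Data.Unit using (tt)
open import Data.Product using (_,_)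
open import Data.Sum using (inj₁; inj₂)
open import Data.Empty using (⊥-elim)
open import Relation.Nullary using (yes; no)
open import Relation.Binary.PropositionalEquality
  using (refl; sym; trans; cong; cong₂; subst; subst₂; module ≡-Reasoning)

-- Pascal's triangle.  Unlike the library's factorial-based `_C_` it unfolds
-- by the recurrence C(n+1,k+1) = C(n,k) + C(n,k+1), which is exactly the
-- step of every induction on n below.
choose : ℕ → ℕ → ℕ
choose zero    zero    = 1
choose zero    (suc k) = 0
choose (suc n) zero    = 1
choose (suc n) (suc k) = choose n k + choose n (suc k)

C≡choose : ∀ n k → n C k ≡ choose n k
C≡choose zero    zero    = refl
C≡choose zero    (suc k) = refl
C≡choose (suc n) zero    = refl
C≡choose (suc n) (suc k) =
  trans (sym (nCk+nC[k+1]≡[n+1]C[k+1] n k)) (cong₂ _+_ (C≡choose n k) (C≡choose n (suc k)))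

choose-zeroʳ : ∀ n → choose n 0 ≡ 1
choose-zeroʳ zero    = refl
choose-zeroʳ (suc n) = refl

choose-oneʳ : ∀ n → choose n 1 ≡ n
choose-oneʳ zero    = refl
choose-oneʳ (suc n) = cong₂ _+_ (choose-zeroʳ n) (choose-oneʳ n)

choose-vanishes : ∀ {n k} → n < k → choose n k ≡ 0
choose-vanishes {zero}  {suc k} _         = refl
choose-vanishes {suc n} {suc k} (s≤s n<k) =
  cong₂ _+_ (choose-vanishes n<k) (choose-vanishes (m≤n⇒m≤1+n n<k))

choose-positive : ∀ {n k} → k ≤ n → 1 ≤ choose n k
choose-positive {n} {zero}  _         = ≤-reflexive (sym (choose-zeroʳ n))
choose-positive {suc n} {suc k} (s≤s k≤n) = ≤-trans (choose-positive k≤n) (m≤m+n _ _)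

choose≡0⇒< : ∀ n k → choose n k ≡ 0 → n < k
choose≡0⇒< n k C≡0 with k ≤? n
... | yes k≤n = ⊥-elim (<⇒≢ (choose-positive k≤n) (sym C≡0))
... | no  k≰n = ≰⇒> k≰n

-- On and above the diagonal C(n,k) ≤ 1: a positive m ≥ C(n+1,k) then has
-- leading index at least k.
choose-≤1 : ∀ {n k} → n ≤ k → choose n k ≤ 1
choose-≤1 {zero}  {zero}  _         = ≤-refl
choose-≤1 {zero}  {suc k} _         = z≤n
choose-≤1 {suc n} {suc k} (s≤s n≤k) =
  subst (_≤ 1) (sym (trans (cong (choose n k +_) (choose-vanishes (s≤s n≤k))) (+-identityʳ _)))
    (choose-≤1 n≤k)

choose-monoˡ : ∀ k {m n} → m ≤ n → choose m k ≤ choose n k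
choose-monoˡ k m≤n = go (≤⇒≤′ m≤n)
  where
  step : ∀ n j → choose n j ≤ choose (suc n) j
  step n zero    = ≤-reflexive (choose-zeroʳ n)
  step n (suc j) = m≤n+m _ _
  go : ∀ {m n} → m ≤′ n → choose m k ≤ choose n k
  go ≤′-refl        = ≤-refl
  go (≤′-step m≤′n) = ≤-trans (go m≤′n) (step _ k)

-- C(k+1+d, k+1) ≥ d+1: bounds the leading index of a representation, and
-- places any given number below an entry of column k+1.
choose-lower-bound : ∀ k d → suc d ≤ choose (suc (k + d)) (suc k)
choose-lower-bound zero    d = ≤-reflexive (sym (choose-oneʳ (suc d)))
choose-lower-bound (suc k) d = ≤-trans (choose-lower-bound k d) (m≤m+n _ _)

largest-spec : ∀ i M bound n → n ≤ bound → choose n i ≤ M → M < choose (suc n) i →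
  largest i M bound ≡ n
largest-spec i M zero    .zero z≤n _ _ = refl
largest-spec i M (suc b) n n≤b+1 lower upper with (suc b C i) ≤ᵇ M in fits
... | true with m≤n⇒m<n∨m≡n n≤b+1
...   | inj₂ n≡b+1     = sym n≡b+1
...   | inj₁ (s≤s n≤b) = ⊥-elim (<⇒≱ upper (≤-trans (choose-monoˡ i (s≤s n≤b))
          (subst (_≤ M) (C≡choose (suc b) i) (≤ᵇ⇒≤ _ _ (subst T (sym fits) tt)))))
largest-spec i M (suc b) n n≤b+1 lower upper | false with m≤n⇒m<n∨m≡n n≤b+1
...   | inj₁ (s≤s n≤b) = largest-spec i M b n n≤b lower upper
...   | inj₂ refl      =
  ⊥-elim (subst T fits (≤⇒≤ᵇ (subst (_≤ M) (sym (C≡choose (suc b) i)) lower)))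

-- The leading index n of a positive m (C(n,i+1) ≤ m < C(n+1,i+1)) is at
-- most m+i+1, so the downward search in `largest` starts above it.
leading-index-bound : ∀ i n m → choose n (suc i) ≤ suc m → suc m < choose (suc n) (suc i) →
  n ≤ suc m + suc i
leading-index-bound i n m lower upper with suc i ≤? n
... | no  i≮n = ⊥-elim (<⇒≱ upper (≤-trans (choose-≤1 (≰⇒> i≮n)) (s≤s z≤n)))
... | yes i<n with m≤n⇒∃[o]m+o≡n i<n
...   | d , refl = ≤-trans (≤-reflexive (+-comm (suc i) d))
  (+-monoˡ-≤ (suc i) (≤-trans (n≤1+n d) (≤-trans (choose-lower-bound i d) lower)))

boundary-step : ∀ i n m → choose n (suc i) ≤ suc m → suc m < choose (suc n) (suc i) →
  suc m ⁽ suc i ⁾ ≡ choose n (suc (suc i)) + (suc m ∸ choose n (suc i)) ⁽ i ⁾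
boundary-step i n m lower upper
  rewrite largest-spec (suc i) (suc m) (suc m + suc i) n
                       (leading-index-bound i n m lower upper) lower upper
        | C≡choose n (suc (suc i)) | C≡choose n (suc i) = refl

boundary-zero : ∀ i → 0 ⁽ i ⁾ ≡ 0
boundary-zero zero    = refl
boundary-zero (suc i) = refl

boundary-of-choose : ∀ i n → choose n (suc i) ⁽ suc i ⁾ ≡ choose n (suc (suc i))
boundary-of-choose i n with suc i ≤? n
... | no i≮n
  rewrite choose-vanishes (≰⇒> i≮n) | choose-vanishes (m<n⇒m<1+n (≰⇒> i≮n)) = refl
... | yes i<n with choose n (suc i) in C≡m+1
...   | zero  = ⊥-elim (<⇒≢ (choose-positive i<n) (sym C≡m+1))
...   | suc m = begin
  suc m ⁽ suc i ⁾
    ≡⟨ boundary-step i n m (≤-reflexive C≡m+1) upper ⟩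
  choose n (suc (suc i)) + (suc m ∸ choose n (suc i)) ⁽ i ⁾
    ≡⟨ cong (λ x → choose n (suc (suc i)) + (suc m ∸ x) ⁽ i ⁾) C≡m+1 ⟩
  choose n (suc (suc i)) + (m ∸ m) ⁽ i ⁾
    ≡⟨ cong (λ x → choose n (suc (suc i)) + x ⁽ i ⁾) (n∸n≡0 m) ⟩
  choose n (suc (suc i)) + 0 ⁽ i ⁾
    ≡⟨ cong (choose n (suc (suc i)) +_) (boundary-zero i) ⟩
  choose n (suc (suc i)) + 0
    ≡⟨ +-identityʳ _ ⟩
  choose n (suc (suc i)) ∎
  where
  open ≡-Reasoning
  upper : suc m < choose (suc n) (suc i)
  upper = subst (λ x → suc x ≤ choose n i + choose n (suc i)) C≡m+1
    (+-monoˡ-≤ (choose n (suc i)) (choose-positive (≤-trans (n≤1+n i) i<n)))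

boundary-shift : ∀ i n r → r ≤ choose n (suc i) →
  (choose n (suc (suc i)) + r) ⁽ suc (suc i) ⁾ ≡ choose n (suc (suc (suc i))) + r ⁽ suc i ⁾
boundary-shift i n r r≤C with m≤n⇒m<n∨m≡n r≤C
... | inj₂ refl = begin
  (choose n (suc (suc i)) + choose n (suc i)) ⁽ suc (suc i) ⁾
    ≡⟨ cong _⁽ suc (suc i) ⁾ (+-comm (choose n (suc (suc i))) (choose n (suc i))) ⟩
  choose (suc n) (suc (suc i)) ⁽ suc (suc i) ⁾
    ≡⟨ boundary-of-choose (suc i) (suc n) ⟩
  choose n (suc (suc i)) + choose n (suc (suc (suc i)))
    ≡⟨ +-comm (choose n (suc (suc i))) _ ⟩
  choose n (suc (suc (suc i))) + choose n (suc (suc i))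
    ≡⟨ cong (choose n (suc (suc (suc i))) +_) (sym (boundary-of-choose i n)) ⟩
  choose n (suc (suc (suc i))) + choose n (suc i) ⁽ suc i ⁾ ∎
  where open ≡-Reasoning
... | inj₁ r<C with choose n (suc (suc i)) + r in sum≡
...   | zero
  rewrite m+n≡0⇒n≡0 (choose n (suc (suc i))) sum≡
        | choose-vanishes (m<n⇒m<1+n (choose≡0⇒< n _ (m+n≡0⇒m≡0 _ sum≡))) = refl
...   | suc M = begin
  suc M ⁽ suc (suc i) ⁾
    ≡⟨ boundary-step (suc i) n M (subst (choose n (suc (suc i)) ≤_) sum≡ (m≤m+n _ r)) upper ⟩
  choose n (suc (suc (suc i))) + (suc M ∸ choose n (suc (suc i))) ⁽ suc i ⁾
    ≡⟨ cong (λ x → choose n (suc (suc (suc i))) + (x ∸ choose n (suc (suc i))) ⁽ suc i ⁾)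
         (sym sum≡) ⟩
  choose n (suc (suc (suc i))) + (choose n (suc (suc i)) + r ∸ choose n (suc (suc i))) ⁽ suc i ⁾
    ≡⟨ cong (λ x → choose n (suc (suc (suc i))) + x ⁽ suc i ⁾) (m+n∸m≡n (choose n (suc (suc i))) r) ⟩
  choose n (suc (suc (suc i))) + r ⁽ suc i ⁾ ∎
  where
  open ≡-Reasoning
  upper : suc M < choose (suc n) (suc (suc i))
  upper = subst (_< choose n (suc i) + choose n (suc (suc i)))
    (trans (+-comm r _) sum≡) (+-monoˡ-< (choose n (suc (suc i))) r<C)

boundary-one : ∀ m → m ⁽ 1 ⁾ ≡ choose m 2
boundary-one zero    = refl
boundary-one (suc m) =
  trans (boundary-step 0 (suc m) m (≤-reflexive (choose-oneʳ (suc m)))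
                       (≤-reflexive (cong suc (sym (choose-oneʳ (suc m))))))
        (+-identityʳ _)

-- Pairs from a disjoint union: C(a+b,2) = C(a,2) + C(b,2) + ab.
choose₂-+ : ∀ a b → choose (a + b) 2 ≡ choose a 2 + choose b 2 + a * b
choose₂-+ zero    b = sym (+-identityʳ _)
choose₂-+ (suc a) b = begin
  choose (suc (a + b)) 2                ≡⟨ cong (_+ choose (a + b) 2) (choose-oneʳ (a + b)) ⟩
  (a + b) + choose (a + b) 2            ≡⟨ cong ((a + b) +_) (choose₂-+ a b) ⟩
  (a + b) + (x + y + a * b)             ≡⟨ regroup a b x y ⟩
  (a + x) + y + suc a * b               ≡⟨ cong (λ z → z + y + suc a * b) (sym (cong (_+ x) (choose-oneʳ a))) ⟩
  choose (suc a) 2 + y + suc a * b      ∎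
  where
  open ≡-Reasoning
  x = choose a 2
  y = choose b 2
  regroup : ∀ a b x y → (a + b) + (x + y + a * b) ≡ (a + x) + y + suc a * b
  regroup = solve-∀

boundary-one-+ : ∀ a b → (a + b) ⁽ 1 ⁾ ≡ a ⁽ 1 ⁾ + b ⁽ 1 ⁾ + a * b
boundary-one-+ a b = begin
  (a + b) ⁽ 1 ⁾                      ≡⟨ boundary-one (a + b) ⟩
  choose (a + b) 2                   ≡⟨ choose₂-+ a b ⟩
  choose a 2 + choose b 2 + a * b    ≡⟨ sym (cong₂ (λ x y → x + y + a * b) (boundary-one a) (boundary-one b)) ⟩
  a ⁽ 1 ⁾ + b ⁽ 1 ⁾ + a * b          ∎
  where open ≡-Reasoning

absorption : ∀ m k → suc k * choose m (suc k) + k * choose m k ≡ m * choose m k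
absorption zero    zero    = refl
absorption zero    (suc k) = cong₂ _+_ (*-zeroʳ (suc (suc k))) (*-zeroʳ (suc k))
absorption (suc m) zero    rewrite choose-oneʳ m | choose-zeroʳ m =
  trans (+-identityʳ (1 * suc m)) (trans (*-identityˡ (suc m)) (sym (*-identityʳ (suc m))))
absorption (suc m) (suc k) = begin
  suc (suc k) * (y + z) + suc k * (x + y)                    ≡⟨ regroup₁ k x y z ⟩
  suc (suc k) * y + (suc (suc k) * z + suc k * y) + suc k * x ≡⟨ cong (λ u → suc (suc k) * y + u + suc k * x) (absorption m (suc k)) ⟩
  suc (suc k) * y + m * y + suc k * x                        ≡⟨ regroup₂ k m x y ⟩
  (suc k * y + k * x) + x + m * y + y                        ≡⟨ cong (λ u → u + x + m * y + y) (absorption m k) ⟩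
  m * x + x + m * y + y                                      ≡⟨ regroup₃ m x y ⟩
  suc m * (x + y)                                            ∎
  where
  open ≡-Reasoning
  x = choose m k
  y = choose m (suc k)
  z = choose m (suc (suc k))
  regroup₁ : ∀ k x y z → suc (suc k) * (y + z) + suc k * (x + y)
                       ≡ suc (suc k) * y + (suc (suc k) * z + suc k * y) + suc k * x
  regroup₁ = solve-∀
  regroup₂ : ∀ k m x y → suc (suc k) * y + m * y + suc k * x ≡ (suc k * y + k * x) + x + m * y + y
  regroup₂ = solve-∀
  regroup₃ : ∀ m x y → m * x + x + m * y + y ≡ suc m * (x + y)
  regroup₃ = solve-∀

-- Unimodality of a row of Pascal's triangle, in the form needed: a number
-- bounded by both C(m,k) and C(m,k+2) is bounded by C(m,k+1).
-- (If C(m,k+1) were below both neighbours, absorption would give both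
-- m ≤ 2k and m > 2k+2.)
choose-unimodal : ∀ m k t → t ≤ choose m k → t ≤ choose m (suc (suc k)) → t ≤ choose m (suc k)
choose-unimodal m k t t≤x t≤z with t ≤? choose m (suc k)
... | yes t≤y = t≤y
... | no  t≰y = ⊥-elim (<⇒≱ m·y-large m·y-small)
  where
  x = choose m k
  y = choose m (suc k)
  z = choose m (suc (suc k))
  y<t : y < t
  y<t = ≰⇒> t≰y
  m≤2k : m ≤ k + k
  m≤2k = ≤-pred (*-cancelʳ-< x m (suc k + k)
    (subst₂ _<_ (absorption m k) (sym (*-distribʳ-+ x (suc k) k))
      (+-monoˡ-< (k * x) (*-monoʳ-< (suc k) (<-≤-trans y<t t≤x)))))
  m·y-large : suc (suc k) * y + suc k * y < m * y
  m·y-large = subst (suc (suc k) * y + suc k * y <_) (absorption m (suc k))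
    (+-monoˡ-< (suc k * y) (*-monoʳ-< (suc (suc k)) (<-≤-trans y<t t≤z)))
  m·y-small : m * y ≤ suc (suc k) * y + suc k * y
  m·y-small = ≤-trans (*-monoˡ-≤ y (≤-trans m≤2k (+-mono-≤ (m≤n+m k 2) (n≤1+n k))))
    (≤-reflexive (*-distribʳ-+ y (suc (suc k)) (suc k)))

≤-by-slack : ∀ {l r} d → l + d ≡ r → l ≤ r
≤-by-slack {l} d l+d≡r = subst (l ≤_) l+d≡r (m≤m+n l d)

cancel-summand : ∀ e {a x y} → e + a ≡ e + x + y → a ≡ x + y
cancel-summand e {a} {x} {y} eq = +-cancelˡ-≡ e a (x + y) (trans eq (+-assoc e x y))

overlap-sum : ∀ s L w → s + L + w + s ≡ (s + L) + (s + w)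
overlap-sum = solve-∀

-- The three properties of the (k+1)-boundary, proved together by induction on k.
record BoundaryLaws (k : ℕ) : Set where
  field
    superadditive : ∀ a b → a ⁽ suc k ⁾ + b ⁽ suc k ⁾ ≤ (a + b) ⁽ suc k ⁾
    -- Lemma 3 with m = s, m₁ = s + L, m₂ = s + w, for the row n.
    pair-bound : ∀ n s L w → s + L + w ≡ choose n (suc k) →
      (s + L) ⁽ suc k ⁾ + (s + w) ⁽ suc k ⁾ ≤ s ⁽ suc k ⁾ + choose n (suc (suc k))
    layer : ∀ m x → x ≤ choose m (suc k) →
      (x + choose m k) ⁽ suc k ⁾ ≤ x ⁽ suc k ⁾ + choose m (suc k)

laws-one : BoundaryLaws 0
laws-one = record { superadditive = superadditive ; pair-bound = pair-bound ; layer = layer }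
  where
  superadditive : ∀ a b → a ⁽ 1 ⁾ + b ⁽ 1 ⁾ ≤ (a + b) ⁽ 1 ⁾
  superadditive a b = ≤-by-slack (a * b) (sym (boundary-one-+ a b))

  pair-bound : ∀ n s L w → s + L + w ≡ choose n 1 →
    (s + L) ⁽ 1 ⁾ + (s + w) ⁽ 1 ⁾ ≤ s ⁽ 1 ⁾ + choose n 2
  pair-bound n s L w sum≡ with trans sum≡ (choose-oneʳ n)
  ... | refl = ≤-by-slack (L * w) (begin
    (s + L) ⁽ 1 ⁾ + (s + w) ⁽ 1 ⁾ + L * w
      ≡⟨ cong₂ (λ x y → x + y + L * w) (boundary-one-+ s L) (boundary-one-+ s w) ⟩
    (∂s + ∂L + s * L) + (∂s + ∂w + s * w) + L * w
      ≡⟨ regroup s L w ∂s ∂L ∂w ⟩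
    ∂s + ((∂s + ∂L + s * L) + ∂w + (s + L) * w)
      ≡⟨ cong (λ x → ∂s + (x + ∂w + (s + L) * w)) (sym (boundary-one-+ s L)) ⟩
    ∂s + ((s + L) ⁽ 1 ⁾ + ∂w + (s + L) * w)
      ≡⟨ cong (∂s +_) (sym (boundary-one-+ (s + L) w)) ⟩
    ∂s + (s + L + w) ⁽ 1 ⁾
      ≡⟨ cong (∂s +_) (boundary-one (s + L + w)) ⟩
    ∂s + choose (s + L + w) 2 ∎)
    where
    open ≡-Reasoning
    ∂s = s ⁽ 1 ⁾
    ∂L = L ⁽ 1 ⁾
    ∂w = w ⁽ 1 ⁾
    regroup : ∀ s L w x y z →
      (x + y + s * L) + (x + z + s * w) + L * w ≡ x + ((x + y + s * L) + z + (s + L) * w)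
    regroup = solve-∀

  layer : ∀ m x → x ≤ choose m 1 → (x + choose m 0) ⁽ 1 ⁾ ≤ x ⁽ 1 ⁾ + choose m 1
  layer m x x≤m = begin
    (x + choose m 0) ⁽ 1 ⁾  ≡⟨ cong (λ y → (x + y) ⁽ 1 ⁾) (choose-zeroʳ m) ⟩
    (x + 1) ⁽ 1 ⁾           ≡⟨ boundary-one-+ x 1 ⟩
    x ⁽ 1 ⁾ + 0 + x * 1     ≡⟨ cong₂ _+_ (+-identityʳ _) (*-identityʳ x) ⟩
    x ⁽ 1 ⁾ + x             ≤⟨ +-monoʳ-≤ (x ⁽ 1 ⁾) x≤m ⟩
    x ⁽ 1 ⁾ + choose m 1    ∎
    where open ≤-Reasoning

-- Each claim about
-- ∂⁺ is proved by induction on a row n of Pascal's triangle: the next row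
-- splits as C(n+1,k+2) = C(n,k+1) + C(n,k+2), and `boundary-shift` turns ∂⁺
-- above C(n,k+2) into ∂, where the laws of level k+1 apply.
module Ascend (k : ℕ) (lower : BoundaryLaws k) where
  open BoundaryLaws lower
  open ≤-Reasoning

  ∂ ∂⁺ : ℕ → ℕ
  ∂ x = x ⁽ suc k ⁾
  ∂⁺ x = x ⁽ suc (suc k) ⁾

  module Row (m : ℕ) where
    c₀ c₁ c₂ c₃ : ℕ
    c₀ = choose m k
    c₁ = choose m (suc k)
    c₂ = choose m (suc (suc k))
    c₃ = choose m (suc (suc (suc k)))

  complement-bound : ∀ n e a b → e + a ≡ choose n (suc (suc k)) → e + b ≡ choose n (suc k) →
    ∂ b + choose n (suc (suc (suc k))) ≤ ∂⁺ a + choose n (suc (suc k))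
  complement-bound zero    zero    zero    zero    _  _  = z≤n
  complement-bound zero    (suc e) a       b       () _
  complement-bound zero    zero    (suc a) b       () _
  complement-bound zero    zero    zero    (suc b) _  ()
  complement-bound (suc m) e a b ea≡ eb≡ with e ≤? choose m (suc k)
  ... | yes e≤c₁ = begin
    ∂ b + (c₂ + c₃)          ≡⟨ cong (λ y → ∂ y + (c₂ + c₃)) b≡ ⟩
    ∂ (x + c₀) + (c₂ + c₃)   ≤⟨ +-monoˡ-≤ (c₂ + c₃) (layer m x x≤c₁) ⟩
    ∂ x + c₁ + (c₂ + c₃)     ≡⟨ regroup (∂ x) c₁ c₂ c₃ ⟩
    (c₃ + ∂ x) + (c₁ + c₂)   ≡⟨ cong (_+ (c₁ + c₂)) (boundary-shift k m x x≤c₁) ⟨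
    ∂⁺ (c₂ + x) + (c₁ + c₂)  ≡⟨ cong (λ y → ∂⁺ y + (c₁ + c₂)) (trans (+-comm c₂ x) (sym a≡)) ⟩
    ∂⁺ a + (c₁ + c₂)         ∎
    where
    open Row m
    x = c₁ ∸ e
    ex≡ : e + x ≡ c₁
    ex≡ = m+[n∸m]≡n e≤c₁
    x≤c₁ : x ≤ c₁
    x≤c₁ = m∸n≤m c₁ e
    a≡ : a ≡ x + c₂
    a≡ = cancel-summand e (trans ea≡ (cong (_+ c₂) (sym ex≡)))
    b≡ : b ≡ x + c₀
    b≡ = cancel-summand e (trans eb≡ (trans (+-comm c₀ c₁) (cong (_+ c₀) (sym ex≡))))
    regroup : ∀ u c₁ c₂ c₃ → u + c₁ + (c₂ + c₃) ≡ (c₃ + u) + (c₁ + c₂)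
    regroup = solve-∀
  ... | no e≰c₁ = begin
    ∂ b + (c₂ + c₃)     ≡⟨ +-assoc (∂ b) c₂ c₃ ⟨
    ∂ b + c₂ + c₃       ≡⟨ cong (λ z → ∂ b + z + c₃) (boundary-of-choose k m) ⟨
    ∂ b + ∂ c₁ + c₃     ≤⟨ +-monoˡ-≤ c₃ (superadditive b c₁) ⟩
    ∂ (b + c₁) + c₃     ≡⟨ cong (λ z → ∂ z + c₃) b+c₁≡ ⟩
    ∂ (y + c₀) + c₃     ≤⟨ +-monoˡ-≤ c₃ (layer m y (m∸n≤m c₁ t)) ⟩
    ∂ y + c₁ + c₃       ≡⟨ xy∙z≈xz∙y (∂ y) c₁ c₃ ⟩
    ∂ y + c₃ + c₁       ≤⟨ +-monoˡ-≤ c₁ (complement-bound m t a y ta≡ ty≡) ⟩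
    ∂⁺ a + c₂ + c₁      ≡⟨ xy∙z≈x∙zy (∂⁺ a) c₂ c₁ ⟩
    ∂⁺ a + (c₁ + c₂)    ∎
    where
    open Row m
    t = e ∸ c₁
    et≡ : c₁ + t ≡ e
    et≡ = m+[n∸m]≡n (<⇒≤ (≰⇒> e≰c₁))
    ta≡ : t + a ≡ c₂
    ta≡ = sym (cancel-summand c₁ (sym (trans (cong (_+ a) et≡) ea≡)))
    tb≡ : t + b ≡ c₀
    tb≡ = sym (cancel-summand c₁ (sym (trans (cong (_+ b) et≡) (trans eb≡ (+-comm c₀ c₁)))))
    -- t lies below both C(m,k) and C(m,k+2), hence below C(m,k+1)
    t≤c₁ : t ≤ c₁
    t≤c₁ = choose-unimodal m k t (subst (t ≤_) tb≡ (m≤m+n t b)) (subst (t ≤_) ta≡ (m≤m+n t a))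
    y = c₁ ∸ t
    ty≡ : t + y ≡ c₁
    ty≡ = m+[n∸m]≡n t≤c₁
    b+c₁≡ : b + c₁ ≡ y + c₀
    b+c₁≡ = trans (cong (b +_) (sym ty≡))
      (trans (x∙yz≈yx∙z b t y) (trans (cong (_+ y) tb≡) (+-comm c₀ y)))

  PairBound⁺ : ℕ → Set
  PairBound⁺ n = ∀ s L w → s + L + w ≡ choose n (suc (suc k)) →
    ∂⁺ (s + L) + ∂⁺ (s + w) ≤ ∂⁺ s + choose n (suc (suc (suc k)))

  mixed-bound : ∀ n → PairBound⁺ n → ∀ s p q w →
    s + p ≡ choose n (suc (suc k)) → q + w ≡ choose n (suc k) →
    ∂ q + ∂⁺ (s + w) ≤ ∂⁺ s + choose n (suc (suc k))
  mixed-bound n pair s p q w sp≡ qw≡ with w ≤? p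
  ... | yes w≤p = +-cancelʳ-≤ (∂⁺ (s + v) + c₃) _ _ (begin
    ∂ q + ∂⁺ (s + w) + (∂⁺ (s + v) + c₃)        ≡⟨ regroupˡ (∂ q) (∂⁺ (s + w)) (∂⁺ (s + v)) c₃ ⟩
    (∂⁺ (s + w) + ∂⁺ (s + v)) + (∂ q + c₃)      ≤⟨ +-mono-≤ (pair s w v swv≡)
                                                     (complement-bound n w (s + v) q wsv≡ wq≡) ⟩
    (∂⁺ s + c₃) + (∂⁺ (s + v) + c₂)             ≡⟨ regroupʳ (∂⁺ s) c₃ (∂⁺ (s + v)) c₂ ⟩
    ∂⁺ s + c₂ + (∂⁺ (s + v) + c₃)               ∎)
    where
    open Row n
    v = p ∸ w
    wv≡ : w + v ≡ p
    wv≡ = m+[n∸m]≡n w≤p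
    swv≡ : s + w + v ≡ c₂
    swv≡ = trans (+-assoc s w v) (trans (cong (s +_) wv≡) sp≡)
    wsv≡ : w + (s + v) ≡ c₂
    wsv≡ = trans (x∙yz≈y∙xz w s v) (trans (cong (s +_) wv≡) sp≡)
    wq≡ : w + q ≡ c₁
    wq≡ = trans (+-comm w q) qw≡
    regroupˡ : ∀ a b c d → a + b + (c + d) ≡ (b + c) + (a + d)
    regroupˡ = solve-∀
    regroupʳ : ∀ a b c d → (a + b) + (c + d) ≡ a + d + (c + b)
    regroupʳ = solve-∀
  ... | no w≰p = begin
    ∂ q + ∂⁺ (s + w)         ≡⟨ cong (λ z → ∂ q + ∂⁺ z) sw≡ ⟩
    ∂ q + ∂⁺ (c₂ + v)        ≡⟨ cong (∂ q +_) (boundary-shift k n v v≤c₁) ⟩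
    ∂ q + (c₃ + ∂ v)         ≡⟨ x∙yz≈xz∙y (∂ q) c₃ (∂ v) ⟩
    ∂ q + ∂ v + c₃           ≤⟨ +-monoˡ-≤ c₃ (superadditive q v) ⟩
    ∂ (q + v) + c₃           ≤⟨ complement-bound n p s (q + v) (trans (+-comm p s) sp≡) pqv≡ ⟩
    ∂⁺ s + c₂                ∎
    where
    open Row n
    v = w ∸ p
    pv≡ : p + v ≡ w
    pv≡ = m+[n∸m]≡n (<⇒≤ (≰⇒> w≰p))
    sw≡ : s + w ≡ c₂ + v
    sw≡ = trans (cong (s +_) (sym pv≡)) (trans (sym (+-assoc s p v)) (cong (_+ v) sp≡))
    v≤c₁ : v ≤ c₁
    v≤c₁ = subst (v ≤_) qw≡ (≤-trans (m∸n≤m w p) (m≤n+m w q))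
    pqv≡ : p + (q + v) ≡ c₁
    pqv≡ = trans (x∙yz≈y∙xz p q v) (trans (cong (q +_) pv≡) qw≡)

  -- Lemma 3 for ∂⁺, by induction on the row; the three cases compare the
  -- window [s, s+L] with the leading block C(n,k+2) of the next row.
  pair-bound⁺ : ∀ n → PairBound⁺ n
  pair-bound⁺ zero    zero    zero    zero    _  = z≤n
  pair-bound⁺ zero    (suc s) L       w       ()
  pair-bound⁺ zero    zero    (suc L) w       ()
  pair-bound⁺ zero    zero    zero    (suc w) ()
  pair-bound⁺ (suc m) s L w sum≡ with s + L ≤? choose m (suc (suc k))
  ... | yes s+L≤c₂ = +-cancelʳ-≤ (∂⁺ (s + w′)) _ _ (begin
    ∂⁺ (s + L) + ∂⁺ (s + w) + ∂⁺ (s + w′)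
      ≡⟨ xy∙z≈xz∙y (∂⁺ (s + L)) (∂⁺ (s + w)) (∂⁺ (s + w′)) ⟩
    ∂⁺ (s + L) + ∂⁺ (s + w′) + ∂⁺ (s + w)
      ≡⟨ cong (λ z → ∂⁺ (s + L) + ∂⁺ (s + w′) + ∂⁺ z) s+w≡ ⟩
    ∂⁺ (s + L) + ∂⁺ (s + w′) + ∂⁺ (s + w′ + c₁)
      ≤⟨ +-mono-≤ (pair-bound⁺ m s L w′ sLw′≡)
                  (mixed-bound m (pair-bound⁺ m) (s + w′) L 0 c₁ sw′L≡ refl) ⟩
    (∂⁺ s + c₃) + (∂⁺ (s + w′) + c₂)
      ≡⟨ regroup (∂⁺ s) c₃ (∂⁺ (s + w′)) c₂ ⟩
    ∂⁺ s + (c₂ + c₃) + ∂⁺ (s + w′) ∎)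
    where
    open Row m
    w′ = c₂ ∸ (s + L)
    sLw′≡ : s + L + w′ ≡ c₂
    sLw′≡ = m+[n∸m]≡n s+L≤c₂
    sw′L≡ : s + w′ + L ≡ c₂
    sw′L≡ = trans (xy∙z≈xz∙y s w′ L) sLw′≡
    s+w≡ : s + w ≡ s + w′ + c₁
    s+w≡ = trans (cong (s +_) (cancel-summand (s + L)
      (trans sum≡ (trans (+-comm c₁ c₂) (cong (_+ c₁) (sym sLw′≡)))))) (sym (+-assoc s w′ c₁))
    regroup : ∀ a d c b → (a + d) + (c + b) ≡ a + (b + d) + c
    regroup = solve-∀
  ... | no s+L≰c₂ with choose m (suc (suc k)) ≤? s
  ...   | yes c₂≤s = begin
    ∂⁺ (s + L) + ∂⁺ (s + w)
      ≡⟨ cong₂ (λ x y → ∂⁺ x + ∂⁺ y) (split L) (split w) ⟩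
    ∂⁺ (c₂ + (u + L)) + ∂⁺ (c₂ + (u + w))
      ≡⟨ cong₂ _+_ (boundary-shift k m (u + L) uL≤c₁) (boundary-shift k m (u + w) uw≤c₁) ⟩
    (c₃ + ∂ (u + L)) + (c₃ + ∂ (u + w))
      ≡⟨ interchange c₃ (∂ (u + L)) c₃ (∂ (u + w)) ⟩
    (c₃ + c₃) + (∂ (u + L) + ∂ (u + w))
      ≤⟨ +-monoʳ-≤ (c₃ + c₃) (pair-bound m u L w uLw≡) ⟩
    (c₃ + c₃) + (∂ u + c₂)
      ≡⟨ regroup c₃ (∂ u) c₂ ⟩
    (c₃ + ∂ u) + (c₂ + c₃)
      ≡⟨ cong (_+ (c₂ + c₃)) (boundary-shift k m u uc₁) ⟨
    ∂⁺ (c₂ + u) + (c₂ + c₃)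
      ≡⟨ cong (λ z → ∂⁺ z + (c₂ + c₃)) su≡ ⟩
    ∂⁺ s + (c₂ + c₃) ∎
    where
    open Row m
    u = s ∸ c₂
    su≡ : c₂ + u ≡ s
    su≡ = m+[n∸m]≡n c₂≤s
    split : ∀ x → s + x ≡ c₂ + (u + x)
    split x = trans (cong (_+ x) (sym su≡)) (+-assoc c₂ u x)
    uLw≡ : u + L + w ≡ c₁
    uLw≡ = +-cancelˡ-≡ c₂ _ _ (begin-equality
      c₂ + (u + L + w)   ≡⟨ trans (cong (_+ w) (split L)) (+-assoc c₂ (u + L) w) ⟨
      s + L + w          ≡⟨ sum≡ ⟩
      c₁ + c₂            ≡⟨ +-comm c₁ c₂ ⟩
      c₂ + c₁            ∎)
    uL≤c₁ : u + L ≤ c₁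
    uL≤c₁ = subst (u + L ≤_) uLw≡ (m≤m+n (u + L) w)
    uw≤c₁ : u + w ≤ c₁
    uw≤c₁ = subst (u + w ≤_) uLw≡ (subst (u + w ≤_) (xy∙z≈xz∙y u w L) (m≤m+n (u + w) L))
    uc₁ : u ≤ c₁
    uc₁ = ≤-trans (m≤m+n u L) uL≤c₁
    regroup : ∀ d x a → (d + d) + (x + a) ≡ (d + x) + (a + d)
    regroup = solve-∀
  ...   | no c₂≰s = begin
    ∂⁺ (s + L) + ∂⁺ (s + w)     ≡⟨ cong (λ z → ∂⁺ z + ∂⁺ (s + w)) sL≡ ⟩
    ∂⁺ (c₂ + q) + ∂⁺ (s + w)    ≡⟨ cong (_+ ∂⁺ (s + w)) (boundary-shift k m q q≤c₁) ⟩
    c₃ + ∂ q + ∂⁺ (s + w)       ≡⟨ +-assoc c₃ (∂ q) (∂⁺ (s + w)) ⟩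
    c₃ + (∂ q + ∂⁺ (s + w))     ≤⟨ +-monoʳ-≤ c₃ (mixed-bound m (pair-bound⁺ m) s p q w sp≡ qw≡) ⟩
    c₃ + (∂⁺ s + c₂)            ≡⟨ x∙yz≈y∙zx c₃ (∂⁺ s) c₂ ⟩
    ∂⁺ s + (c₂ + c₃)            ∎
    where
    open Row m
    p = c₂ ∸ s
    sp≡ : s + p ≡ c₂
    sp≡ = m+[n∸m]≡n (<⇒≤ (≰⇒> c₂≰s))
    p≤L : p ≤ L
    p≤L = +-cancelˡ-≤ s p L (subst (_≤ s + L) (sym sp≡) (<⇒≤ (≰⇒> s+L≰c₂)))
    q = L ∸ p
    sL≡ : s + L ≡ c₂ + q
    sL≡ = trans (cong (s +_) (sym (m+[n∸m]≡n p≤L))) (trans (sym (+-assoc s p q)) (cong (_+ q) sp≡))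
    qw≡ : q + w ≡ c₁
    qw≡ = +-cancelˡ-≡ c₂ _ _
      (trans (sym (+-assoc c₂ q w)) (trans (cong (_+ w) (sym sL≡)) (trans sum≡ (+-comm c₁ c₂))))
    q≤c₁ : q ≤ c₁
    q≤c₁ = subst (q ≤_) qw≡ (m≤m+n q w)

  layer⁺ : ∀ m x → x ≤ choose m (suc (suc k)) →
    ∂⁺ (x + choose m (suc k)) ≤ ∂⁺ x + choose m (suc (suc k))
  layer⁺ m x x≤c₂ =
    mixed-bound m (pair-bound⁺ m) x (choose m (suc (suc k)) ∸ x) 0 (choose m (suc k))
      (m+[n∸m]≡n x≤c₂) refl

  descends : ∀ x → ∂⁺ x ≤ ∂ x
  descends x = below (suc (suc k) + x) x (≤-trans (n≤1+n x) (choose-lower-bound (suc k) x))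
    where
    below : ∀ n x → x ≤ choose n (suc (suc k)) → ∂⁺ x ≤ ∂ x
    below zero    zero    _ = z≤n
    below (suc m) x x≤ with x ≤? choose m (suc (suc k))
    ... | yes x≤c₂ = below m x x≤c₂
    ... | no  x≰c₂ = begin
      ∂⁺ x           ≡⟨ cong ∂⁺ cr≡ ⟨
      ∂⁺ (c₂ + r)    ≡⟨ boundary-shift k m r r≤c₁ ⟩
      c₃ + ∂ r       ≡⟨ cong (_+ ∂ r) (boundary-of-choose (suc k) m) ⟨
      ∂⁺ c₂ + ∂ r    ≤⟨ +-monoˡ-≤ (∂ r) (below m c₂ ≤-refl) ⟩
      ∂ c₂ + ∂ r     ≤⟨ superadditive c₂ r ⟩
      ∂ (c₂ + r)     ≡⟨ cong ∂ cr≡ ⟩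
      ∂ x            ∎
      where
      open Row m
      r = x ∸ c₂
      cr≡ : c₂ + r ≡ x
      cr≡ = m+[n∸m]≡n (<⇒≤ (≰⇒> x≰c₂))
      r≤c₁ : r ≤ c₁
      r≤c₁ = +-cancelˡ-≤ c₂ r c₁ (subst₂ _≤_ (sym cr≡) (+-comm c₁ c₂) x≤)

  superadditive-above : ∀ m a b → choose m (suc (suc k)) ≤ a →
    a + b ≤ choose (suc m) (suc (suc k)) → ∂⁺ a + ∂⁺ b ≤ ∂⁺ (a + b)
  superadditive-above m a b c₂≤a a+b≤ = begin
    ∂⁺ a + ∂⁺ b               ≡⟨ cong (λ z → ∂⁺ z + ∂⁺ b) ua≡ ⟨
    ∂⁺ (c₂ + u) + ∂⁺ b        ≡⟨ cong (_+ ∂⁺ b) (boundary-shift k m u (≤-trans (m≤m+n u b) ub≤c₁)) ⟩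
    c₃ + ∂ u + ∂⁺ b           ≤⟨ +-monoʳ-≤ (c₃ + ∂ u) (descends b) ⟩
    c₃ + ∂ u + ∂ b            ≡⟨ +-assoc c₃ (∂ u) (∂ b) ⟩
    c₃ + (∂ u + ∂ b)          ≤⟨ +-monoʳ-≤ c₃ (superadditive u b) ⟩
    c₃ + ∂ (u + b)            ≡⟨ boundary-shift k m (u + b) ub≤c₁ ⟨
    ∂⁺ (c₂ + (u + b))         ≡⟨ cong ∂⁺ (trans (sym (+-assoc c₂ u b)) (cong (_+ b) ua≡)) ⟩
    ∂⁺ (a + b)                ∎
    where
    open Row m
    u = a ∸ c₂
    ua≡ : c₂ + u ≡ a
    ua≡ = m+[n∸m]≡n c₂≤a
    ub≤c₁ : u + b ≤ c₁
    ub≤c₁ = +-cancelˡ-≤ c₂ (u + b) c₁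
      (subst₂ _≤_ (trans (cong (_+ b) (sym ua≡)) (+-assoc c₂ u b)) (+-comm c₁ c₂) a+b≤)

  -- Superadditivity of ∂⁺, by induction on a row containing a + b: either
  -- one summand covers the leading block, or both are below it and Lemma 3
  -- on the row applies to the overlap r = a + b − C(m,k+2).
  superadditive⁺ : ∀ a b → ∂⁺ a + ∂⁺ b ≤ ∂⁺ (a + b)
  superadditive⁺ a b =
    below (suc (suc k) + (a + b)) a b (≤-trans (n≤1+n _) (choose-lower-bound (suc k) (a + b)))
    where
    below : ∀ n a b → a + b ≤ choose n (suc (suc k)) → ∂⁺ a + ∂⁺ b ≤ ∂⁺ (a + b)
    below zero    zero    zero    _ = z≤n
    below (suc m) a b a+b≤ with a + b ≤? choose m (suc (suc k))
    ... | yes a+b≤c₂ = below m a b a+b≤c₂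
    ... | no  a+b≰c₂ with choose m (suc (suc k)) ≤? a | choose m (suc (suc k)) ≤? b
    ...   | yes c₂≤a | _         = superadditive-above m a b c₂≤a a+b≤
    ...   | no  _    | yes c₂≤b  = subst₂ _≤_ (+-comm (∂⁺ b) (∂⁺ a)) (cong ∂⁺ (+-comm b a))
      (superadditive-above m b a c₂≤b (subst (_≤ choose (suc m) (suc (suc k))) (+-comm a b) a+b≤))
    ...   | no  c₂≰a | no  c₂≰b  = begin
      ∂⁺ a + ∂⁺ b                ≡⟨ cong₂ (λ x y → ∂⁺ x + ∂⁺ y) (m+[n∸m]≡n r≤a) (m+[n∸m]≡n r≤b) ⟨
      ∂⁺ (r + L) + ∂⁺ (r + w)    ≤⟨ pair-bound⁺ m r L w rLw≡ ⟩
      ∂⁺ r + c₃                  ≤⟨ +-monoˡ-≤ c₃ (descends r) ⟩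
      ∂ r + c₃                   ≡⟨ +-comm (∂ r) c₃ ⟩
      c₃ + ∂ r                   ≡⟨ boundary-shift k m r r≤c₁ ⟨
      ∂⁺ (c₂ + r)                ≡⟨ cong ∂⁺ cr≡ ⟩
      ∂⁺ (a + b)                 ∎
      where
      open Row m
      r = a + b ∸ c₂
      cr≡ : c₂ + r ≡ a + b
      cr≡ = m+[n∸m]≡n (<⇒≤ (≰⇒> a+b≰c₂))
      r≤a : r ≤ a
      r≤a = +-cancelˡ-≤ c₂ r a (subst₂ _≤_ (sym cr≡) (+-comm a c₂) (+-monoʳ-≤ a (<⇒≤ (≰⇒> c₂≰b))))
      r≤b : r ≤ b
      r≤b = +-cancelˡ-≤ c₂ r b (subst (_≤ c₂ + b) (sym cr≡) (+-monoˡ-≤ b (<⇒≤ (≰⇒> c₂≰a))))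
      r≤c₁ : r ≤ c₁
      r≤c₁ = +-cancelˡ-≤ c₂ r c₁ (subst₂ _≤_ (sym cr≡) (+-comm c₁ c₂) a+b≤)
      L = a ∸ r
      w = b ∸ r
      rLw≡ : r + L + w ≡ c₂
      rLw≡ = +-cancelʳ-≡ r _ _ (begin-equality
        r + L + w + r         ≡⟨ overlap-sum r L w ⟩
        (r + L) + (r + w)     ≡⟨ cong₂ _+_ (m+[n∸m]≡n r≤a) (m+[n∸m]≡n r≤b) ⟩
        a + b                 ≡⟨ cr≡ ⟨
        c₂ + r                ∎)

  laws⁺ : BoundaryLaws (suc k)
  laws⁺ = record { superadditive = superadditive⁺ ; pair-bound = pair-bound⁺ ; layer = layer⁺ }

laws : ∀ k → BoundaryLaws k
laws zero    = laws-one
laws (suc k) = Ascend.laws⁺ k (laws k)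

-- Lemma 3.  Writing m₁ = m + L and m₂ = m + w (possible since m₁, m₂ ≥ m),
-- the hypothesis says m + L + w = C(N,i), and the claim is `pair-bound`.
lemma3 : (i N m m₁ m₂ : ℕ) → 1 ≤ i → 1 ≤ N →
    m ≤ N C i → m₁ ≤ N C i → m₂ ≤ N C i →
    m₁ + m₂ ≡ m + N C i →
    m₁ ⁽ i ⁾ + m₂ ⁽ i ⁾ ≤ m ⁽ i ⁾ + N C suc i
lemma3 zero    _ _ _ _ () _ _ _ _ _
lemma3 (suc k) N m m₁ m₂ _ _ _ m₁≤top m₂≤top sum≡ = begin
  m₁ ⁽ suc k ⁾ + m₂ ⁽ suc k ⁾
    ≡⟨ cong₂ (λ x y → x ⁽ suc k ⁾ + y ⁽ suc k ⁾) (m+[n∸m]≡n m≤m₁) (m+[n∸m]≡n m≤m₂) ⟨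
  (m + L) ⁽ suc k ⁾ + (m + w) ⁽ suc k ⁾
    ≤⟨ BoundaryLaws.pair-bound (laws k) N m L w (trans mLw≡top (C≡choose N (suc k))) ⟩
  m ⁽ suc k ⁾ + choose N (suc (suc k))
    ≡⟨ cong (m ⁽ suc k ⁾ +_) (C≡choose N (suc (suc k))) ⟨
  m ⁽ suc k ⁾ + N C suc (suc k) ∎
  where
  open ≤-Reasoning
  top = N C suc k
  m≤m₁ : m ≤ m₁
  m≤m₁ = +-cancelʳ-≤ top m m₁ (subst (_≤ m₁ + top) sum≡ (+-monoʳ-≤ m₁ m₂≤top))
  m≤m₂ : m ≤ m₂
  m≤m₂ = +-cancelʳ-≤ top m m₂ (subst (_≤ m₂ + top) (trans (+-comm m₂ m₁) sum≡) (+-monoʳ-≤ m₂ m₁≤top))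
  L = m₁ ∸ m
  w = m₂ ∸ m
  mLw≡top : m + L + w ≡ top
  mLw≡top = +-cancelʳ-≡ m _ _ (begin-equality
    m + L + w + m        ≡⟨ overlap-sum m L w ⟩
    (m + L) + (m + w)    ≡⟨ cong₂ _+_ (m+[n∸m]≡n m≤m₁) (m+[n∸m]≡n m≤m₂) ⟩
    m₁ + m₂              ≡⟨ sum≡ ⟩
    m + top              ≡⟨ +-comm m top ⟩
    top + m              ∎)
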